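{- Let $k\ge1$, let $\mathcal{A}_k$ be the set of all $k$-atoms, and let $\mathcal{B}_k$ be the set of those $k$-atoms that are not $Tr_k^{(v,e)}$-critical or do not have transitivity equal to $k$. A graph $G$ is $Tr_k^{(v,e)}$-critical if and only if $G\in\mathcal{A}_k'=\mathcal{A}_k\setminus\mathcal{B}_k$.
   Context: All graphs are finite and simple. For disjoint $A,B\subseteq V$, $A$ dominates $B$ if every vertex of $B$ is adjacent to at least one vertex of $A$. A transitive $k$-partition of $G=(V,E)$ is a partition $\{V_1,\dots,V_k\}$ of $V$ into $k$ nonempty parts such that $V_i$ dominates $V_j$ for all $1\le i<j\le k$; the transitivity $Tr(G)$ is the maximum such $k$. A graph $G=(V,E)$ is transitively vertex-edge critical if deleting any element of $V\cup E$ (deleting a vertex removes it with its incident edges) yields a graph of transitivity less than $Tr(G)$; such a graph with $Tr(G)=k$ is $Tr_k^{(v,e)}$-critical. $t$-atoms are defined recursively: the only $1$-atom is $K_1$; if $H=(V,E)$ is a $(t-1)$-atom with $n$ vertices, choose $r\in\{1,\dots,n\}$, a set $I_r$ of $r$ new independent vertices and an $r$-subset $W\subseteq V$, add a perfect matching between $I_r$ and $W$, and join each vertex of $V\setminus W$ by an edge to exactly one (arbitrary) vertex of $I_r$; every graph so obtained is a $t$-atom. Membership in $\mathcal{A}_k$ is up to isomorphism. -}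

module Defs where

open import Data.Nat using (ℕ; zero; suc; _+_; _≤_; _<_)
open import Data.Fin as Fin using (Fin; splitAt; punchIn)
open import Data.Fin.Properties using (any?) renaming (_≟_ to _≟F_)
open import Data.Bool using (Bool; true; false; _∧_; _∨_; not)
open import Data.Sum using (_⊎_; inj₁; inj₂)
open import Data.Product using (Σ; ∃; _×_; _,_)
open import Data.Unit using (⊤)
open import Relation.Nullary using (¬_)
open import Relation.Nullary.Decidable using (⌊_⌋)
open import Relation.Binary.PropositionalEquality using (_≡_)
open import Function.Bundles using (_↔_; Inverse)
open import Function.Definitions using (Injective)

Graph : ℕ → Set
Graph n = Fin n → Fin n → Bool

IsSimple : ∀ {n} → Graph n → Set
IsSimple {n} G = (∀ u v → G u v ≡ G v u) × (∀ v → G v v ≡ false)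

-- A transitive k-partition: part assignment p (vertex v lies in V_{p v + 1}),
-- all parts nonempty, and V_i dominates V_j whenever i < j.
record TransPartition {n} (G : Graph n) (k : ℕ) : Set where
  field
    part     : Fin n → Fin k
    nonempty : ∀ i → ∃ λ v → part v ≡ i
    dominates : ∀ (i j : Fin k) → i Fin.< j → ∀ v → part v ≡ j →
                ∃ λ u → part u ≡ i × G u v ≡ true

TrIs : ∀ {n} → Graph n → ℕ → Set
TrIs G k = TransPartition G k × (∀ m → TransPartition G m → m ≤ k)

TrLess : ∀ {n} → Graph n → ℕ → Set
TrLess G k = ∀ m → TransPartition G m → m < k

deleteVertex : ∀ {m} → Graph (suc m) → Fin (suc m) → Graph m
deleteVertex G v x y = G (punchIn v x) (punchIn v y)

deleteEdge : ∀ {n} → Graph n → Fin n → Fin n → Graph n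
deleteEdge G a b x y =
  G x y ∧ not ((⌊ x ≟F a ⌋ ∧ ⌊ y ≟F b ⌋) ∨ (⌊ x ≟F b ⌋ ∧ ⌊ y ≟F a ⌋))

VertexDeletionsDrop : ∀ {n} → Graph n → ℕ → Set
VertexDeletionsDrop {zero}  G k = ⊤
VertexDeletionsDrop {suc m} G k = ∀ v → TrLess (deleteVertex G v) k

EdgeDeletionsDrop : ∀ {n} → Graph n → ℕ → Set
EdgeDeletionsDrop G k = ∀ a b → G a b ≡ true → TrLess (deleteEdge G a b) k

Critical : ℕ → ∀ {n} → Graph n → Set
Critical k G = TrIs G k × VertexDeletionsDrop G k × EdgeDeletionsDrop G k

-- Construction data for t-atoms with n vertices.
-- step: from a (t-1)-atom H on n vertices, r new vertices (1 ≤ r),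
-- an injection w : Fin r → Fin n (the r-subset W with the perfect matching i ~ w i),
-- and f : Fin n → Fin r choosing the new neighbour of each vertex of V \ W
-- (the values of f on W are ignored).
data Atom : ℕ → ℕ → Set where
  base : Atom 1 1
  step : ∀ {t n} → Atom t n → (r : ℕ) → 1 ≤ r →
         (w : Fin r → Fin n) → Injective _≡_ _≡_ w →
         (f : Fin n → Fin r) → Atom (suc t) (n + r)

inW : ∀ {n r} → (Fin r → Fin n) → Fin n → Bool
inW w u = ⌊ any? (λ j → w j ≟F u) ⌋

cross : ∀ {n r} → (Fin r → Fin n) → (Fin n → Fin r) → Fin n → Fin r → Bool
cross w f u i = ⌊ w i ≟F u ⌋ ∨ (not (inW w u) ∧ ⌊ f u ≟F i ⌋)

extend : ∀ {n r} → Graph n → (Fin r → Fin n) → (Fin n → Fin r) →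
         Fin n ⊎ Fin r → Fin n ⊎ Fin r → Bool
extend H w f (inj₁ u) (inj₁ v) = H u v
extend H w f (inj₁ u) (inj₂ i) = cross w f u i
extend H w f (inj₂ i) (inj₁ u) = cross w f u i
extend H w f (inj₂ i) (inj₂ j) = false

-- old vertices are Fin n (first block), new vertices I_r are the last r
atomGraph : ∀ {t n} → Atom t n → Graph n
atomGraph base x y = false
atomGraph (step {n = n} a r _ w _ f) x y =
  extend (atomGraph a) w f (splitAt n x) (splitAt n y)

Iso : ∀ {n} → Graph n → Graph n → Set
Iso {n} G H = Σ (Fin n ↔ Fin n) λ σ →
  ∀ x y → G x y ≡ H (Inverse.to σ x) (Inverse.to σ y)

InA : ℕ → ∀ {n} → Graph n → Set
InA k {n} G = Σ (Atom k n) λ a → Iso (atomGraph a) G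

InB : ℕ → ∀ {n} → Graph n → Set
InB k G = InA k G × ((¬ Critical k G) ⊎ (¬ TrIs G k))

InA' : ℕ → ∀ {n} → Graph n → Set
InA' k G = InA k G × ¬ InB k G

-- Fix a transitive k-partition V₁, …, V_k of a critical graph and put the vertices of V_i at
-- level i − 1.  Criticality makes this layering rigid: every edge is needed for some domination,
-- so no edge lies inside a part and every vertex has exactly one neighbour in each earlier part;
-- every vertex outside V_k has a neighbour in a later part, since otherwise it could be deleted;
-- and V_k is a single vertex.  Removing V₁ leaves a graph layered in the same way with one level
-- fewer, which by induction is a (k−1)-atom, and V₁ is precisely the independent set I_r by which
-- the atom construction extends it.  Conversely, membership in 𝒜_k' gives criticality only up to
-- double negation; this is removed because transitive partitions of a finite graph are decidable.
module Submission where

open import Defs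
open import Data.Bool using (true; false; _∧_)
import Data.Bool.Properties as Bool
open import Data.Empty using (⊥-elim)
open import Data.Fin as Fin using (Fin; zero; suc; toℕ; fromℕ; fromℕ<; punchIn; punchOut; splitAt)
open import Data.Fin.Properties
  using (any?; all?; _≟_; nonZeroIndex; ¬Fin0; toℕ-injective; toℕ<n; toℕ-fromℕ; toℕ-fromℕ<
        ; punchIn-punchOut; +↔⊎)
  renaming (_<?_ to _<ᶠ?_)
open import Data.Fin.Permutation using (↔⇒≡)
open import Data.Nat using (ℕ; zero; suc; pred; _+_; _≤_; _<_; s≤s; ≢-nonZero; >-nonZero⁻¹)
import Data.Nat.Properties as ℕ
open import Data.Product using (Σ; ∃; ∃₂; _×_; _,_; proj₁; proj₂)
open import Data.Sum using (_⊎_; inj₁; inj₂; map₁; map₂)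
open import Data.Sum.Algebra using (⊎-cong)
open import Data.Sum.Properties using (inj₁-injective; inj₂-injective)
open import Data.Unit using (tt)
open import Data.Vec.Functional using (_∷_; head; tail)
open import Function using (_∘_)
open import Function.Bundles using (_↔_; Inverse; mk↔ₛ′; _⇔_; mk⇔)
open import Function.Consequences.Propositional using (inverseʳ⇒injective; strictlyInverseʳ⇒inverseʳ)
open import Function.Definitions using (Injective)
open import Function.Properties.Inverse using (↔-refl; ↔-trans)
open import Relation.Nullary using (¬_; Dec; yes; no; Stable)
open import Relation.Nullary.Decidable using (⌊_⌋; _×-dec_; _→-dec_; map′; decidable-stable)
open import Relation.Unary using (Pred; Decidable)
open import Relation.Binary.PropositionalEquality

record Partition {n ℓ} (P : Pred (Fin n) ℓ) : Set ℓ where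
  field
    #out #in    : ℕ
    enumeration : (Fin #out ⊎ Fin #in) ↔ Fin n
    out-¬P      : ∀ i → ¬ P (Inverse.to enumeration (inj₁ i))
    in-P        : ∀ j → P (Inverse.to enumeration (inj₂ j))

  open Inverse enumeration

  out-preimage : ∀ {x} → ¬ P x → ∃ λ i → to (inj₁ i) ≡ x
  out-preimage {x} ¬p with from x in eq
  ... | inj₁ i = i , trans (cong to (sym eq)) (strictlyInverseˡ x)
  ... | inj₂ j = ⊥-elim (¬p (subst P (trans (cong to (sym eq)) (strictlyInverseˡ x)) (in-P j)))

  in-preimage : ∀ {x} → P x → ∃ λ j → to (inj₂ j) ≡ x
  in-preimage {x} p with from x in eq
  ... | inj₂ j = j , trans (cong to (sym eq)) (strictlyInverseˡ x)
  ... | inj₁ i = ⊥-elim (out-¬P i (subst P (sym (trans (cong to (sym eq)) (strictlyInverseˡ x))) p))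

  to-injective : Injective _≡_ _≡_ to
  to-injective = inverseʳ⇒injective to inverseʳ

module _ {n ℓ} {P : Pred (Fin (suc n)) ℓ} (Π : Partition (λ x → P (suc x))) where
  open Partition Π
  open Inverse enumeration

  private
    to-in : Fin #out ⊎ Fin (suc #in) → Fin (suc n)
    to-in (inj₁ i)       = suc (to (inj₁ i))
    to-in (inj₂ zero)    = zero
    to-in (inj₂ (suc j)) = suc (to (inj₂ j))

    from-in : Fin (suc n) → Fin #out ⊎ Fin (suc #in)
    from-in zero    = inj₂ zero
    from-in (suc x) = map₂ suc (from x)

    to-out : Fin (suc #out) ⊎ Fin #in → Fin (suc n)
    to-out (inj₁ zero)    = zero
    to-out (inj₁ (suc i)) = suc (to (inj₁ i))
    to-out (inj₂ j)       = suc (to (inj₂ j))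

    from-out : Fin (suc n) → Fin (suc #out) ⊎ Fin #in
    from-out zero    = inj₁ zero
    from-out (suc x) = map₁ suc (from x)

    to-in∘map₂ : ∀ y → to-in (map₂ suc y) ≡ suc (to y)
    to-in∘map₂ (inj₁ _) = refl
    to-in∘map₂ (inj₂ _) = refl

    to-out∘map₁ : ∀ y → to-out (map₁ suc y) ≡ suc (to y)
    to-out∘map₁ (inj₁ _) = refl
    to-out∘map₁ (inj₂ _) = refl

  partition-cons-in : P zero → Partition P
  partition-cons-in p₀ = record
    { enumeration = mk↔ₛ′ to-in from-in
        (λ { zero → refl ; (suc x) → trans (to-in∘map₂ (from x)) (cong suc (strictlyInverseˡ x)) })
        (λ { (inj₁ i) → cong (map₂ suc) (strictlyInverseʳ (inj₁ i))
           ; (inj₂ zero) → refl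
           ; (inj₂ (suc j)) → cong (map₂ suc) (strictlyInverseʳ (inj₂ j)) })
    ; out-¬P = out-¬P
    ; in-P = λ { zero → p₀ ; (suc j) → in-P j } }

  partition-cons-out : ¬ P zero → Partition P
  partition-cons-out ¬p₀ = record
    { enumeration = mk↔ₛ′ to-out from-out
        (λ { zero → refl ; (suc x) → trans (to-out∘map₁ (from x)) (cong suc (strictlyInverseˡ x)) })
        (λ { (inj₁ zero) → refl
           ; (inj₁ (suc i)) → cong (map₁ suc) (strictlyInverseʳ (inj₁ i))
           ; (inj₂ j) → cong (map₁ suc) (strictlyInverseʳ (inj₂ j)) })
    ; out-¬P = λ { zero → ¬p₀ ; (suc i) → out-¬P i }
    ; in-P = in-P }

partition : ∀ n {ℓ} {P : Pred (Fin n) ℓ} → Decidable P → Partition P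
partition zero    P? = record
  { #out = 0 ; #in = 0
  ; enumeration = mk↔ₛ′ (λ { (inj₁ ()) ; (inj₂ ()) }) (λ ()) (λ ()) (λ { (inj₁ ()) ; (inj₂ ()) })
  ; out-¬P = λ () ; in-P = λ () }
partition (suc n) P? with P? zero
... | yes p₀ = partition-cons-in  (partition n (P? ∘ suc)) p₀
... | no ¬p₀ = partition-cons-out (partition n (P? ∘ suc)) ¬p₀

∃-function? : ∀ n {m ℓ} {P : Pred (Fin n → Fin m) ℓ} →
              (∀ {f g} → f ≗ g → P f → P g) → Decidable P → Dec (∃ P)
∃-function? zero resp P? with P? (λ ())
... | yes p = yes (_ , p)
... | no ¬p = no λ (f , pf) → ¬p (resp (λ ()) pf)
∃-function? (suc n) {P = P} resp P?
  with any? (λ a → ∃-function? n (λ f≗g → resp λ { zero → refl ; (suc i) → f≗g i })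
                                  (λ g → P? (a ∷ g)))
... | yes (a , g , p) = yes (a ∷ g , p)
... | no ∄ = no λ (f , pf) → ∄ (head f , tail f , resp (λ { zero → refl ; (suc i) → refl }) pf)

IsTransitive : ∀ {n} → Graph n → (k : ℕ) → (Fin n → Fin k) → Set
IsTransitive G k part =
  (∀ i → ∃ λ v → part v ≡ i) ×
  (∀ i j → i Fin.< j → ∀ v → part v ≡ j → ∃ λ u → part u ≡ i × G u v ≡ true)

isTransitive? : ∀ {n} (G : Graph n) k → Decidable (IsTransitive G k)
isTransitive? G k part =
  all? (λ i → any? (λ v → part v ≟ i)) ×-dec
  all? (λ i → all? (λ j → (i <ᶠ? j) →-dec all? (λ v → (part v ≟ j) →-dec
    any? (λ u → (part u ≟ i) ×-dec (G u v Bool.≟ true)))))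

isTransitive-resp : ∀ {n} (G : Graph n) k {p q} → p ≗ q → IsTransitive G k p → IsTransitive G k q
isTransitive-resp G k p≗q (nonempty , dominates) =
  (λ i → let v , e = nonempty i in v , trans (sym (p≗q v)) e) ,
  (λ i j i<j v e → let u , e₁ , e₂ = dominates i j i<j v (trans (p≗q v) e)
                   in u , trans (sym (p≗q u)) e₁ , e₂)

transPartition? : ∀ {n} (G : Graph n) k → Dec (TransPartition G k)
transPartition? {n} G k = map′
  (λ (part , nonempty , dominates) →
     record { part = part ; nonempty = nonempty ; dominates = dominates })
  (λ P → let open TransPartition P in part , nonempty , dominates)
  (∃-function? n (isTransitive-resp G k) (isTransitive? G k))

private
  ×-stable : {A B : Set} → Stable A → Stable B → Stable (A × B)
  ×-stable sA sB ¬¬ab = sA (λ ¬a → ¬¬ab (¬a ∘ proj₁)) , sB (λ ¬b → ¬¬ab (¬b ∘ proj₂))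

  Π-stable : {A : Set} {B : A → Set} → (∀ x → Stable (B x)) → Stable (∀ x → B x)
  Π-stable sB ¬¬f x = sB x (λ ¬b → ¬¬f (λ f → ¬b (f x)))

trLess-stable : ∀ {n} (G : Graph n) k → Stable (TrLess G k)
trLess-stable G k = Π-stable λ m → Π-stable λ _ → decidable-stable (m ℕ.<? k)

critical-stable : ∀ k {n} (G : Graph n) → Stable (Critical k G)
critical-stable k G =
  ×-stable (×-stable (decidable-stable (transPartition? G k))
                     (Π-stable λ m → Π-stable λ _ → decidable-stable (m ℕ.≤? k)))
           (×-stable (vertexDeletionsDrop-stable G)
                     (Π-stable λ a → Π-stable λ b → Π-stable λ _ → trLess-stable (deleteEdge G a b) k))
  where
  vertexDeletionsDrop-stable : ∀ {n} (G : Graph n) → Stable (VertexDeletionsDrop G k)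
  vertexDeletionsDrop-stable {zero}  G _ = tt
  vertexDeletionsDrop-stable {suc n} G = Π-stable λ v → trLess-stable (deleteVertex G v) k

record Layering {n} (h : ℕ) (G : Graph n) (level : Fin n → ℕ) : Set where
  field
    symmetric              : ∀ u v → G u v ≡ G v u
    level≤h                : ∀ v → level v ≤ h
    edge⇒level≢            : ∀ u v → G u v ≡ true → level u ≢ level v
    lower-neighbour        : ∀ v i → i < level v → ∃ λ u → level u ≡ i × G u v ≡ true
    lower-neighbour-unique : ∀ v u₁ u₂ → level u₁ ≡ level u₂ → level u₁ < level v →
                             G u₁ v ≡ true → G u₂ v ≡ true → u₁ ≡ u₂
    higher-neighbour       : ∀ u → level u < h → ∃ λ v → level u < level v × G u v ≡ true
    top                    : ∃ λ v → level v ≡ h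
    top-unique             : ∀ u v → level u ≡ h → level v ≡ h → u ≡ v

∧-≟-false : ∀ {n} {x a y b : Fin n} → ¬ (x ≡ a × y ≡ b) → ⌊ x ≟ a ⌋ ∧ ⌊ y ≟ b ⌋ ≡ false
∧-≟-false {x = x} {a} {y} {b} ne with x ≟ a | y ≟ b
... | yes p | yes q = ⊥-elim (ne (p , q))
... | yes _ | no _  = refl
... | no _  | _     = refl

deleteEdge-keeps : ∀ {n} (G : Graph n) {a b x y} → G x y ≡ true →
                   ¬ (x ≡ a × y ≡ b) → ¬ (x ≡ b × y ≡ a) → deleteEdge G a b x y ≡ true
deleteEdge-keeps G e ne₁ ne₂ rewrite e | ∧-≟-false ne₁ | ∧-≟-false ne₂ = refl

module CriticalLayering {m k′} (G : Graph (suc m)) (symmetric : ∀ u v → G u v ≡ G v u)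
                        (critical : Critical (suc k′) G) where
  private
    k : ℕ
    k = suc k′

  open TransPartition (proj₁ (proj₁ critical))

  level : Fin (suc m) → ℕ
  level = toℕ ∘ part

  level-< : ∀ {u v i j} → part u ≡ i → part v ≡ j → i Fin.< j → level u < level v
  level-< refl refl i<j = i<j

  Dominates : Graph (suc m) → Set
  Dominates H = ∀ (i j : Fin k) → i Fin.< j → ∀ v → part v ≡ j →
                ∃ λ u → part u ≡ i × H u v ≡ true

  edge-needed : ∀ a b → G a b ≡ true → ¬ Dominates (deleteEdge G a b)
  edge-needed a b e dom = ℕ.<-irrefl refl
    (proj₂ (proj₂ critical) a b e k record { part = part ; nonempty = nonempty ; dominates = dom })

  alone-in-part : ∀ u → (∀ v → G u v ≡ true → ¬ level u < level v) →
                  ∀ u′ → part u′ ≡ part u → u′ ≡ u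
  alone-in-part u no-higher u′ same with u′ ≟ u
  ... | yes u′≡u = u′≡u
  ... | no u′≢u  = ⊥-elim (ℕ.<-irrefl refl (proj₁ (proj₂ critical) u k G-u-transitive))
    where
    survivor : ∀ {x} → x ≢ u → ∃ λ y → punchIn u y ≡ x
    survivor x≢u = punchOut (x≢u ∘ sym) , punchIn-punchOut (x≢u ∘ sym)

    representative : ∀ v → ∃ λ y → part (punchIn u y) ≡ part v
    representative v with v ≟ u
    ... | yes refl = let y , e = survivor u′≢u in y , trans (cong part e) same
    ... | no v≢u   = let y , e = survivor v≢u in y , cong part e

    G-u-transitive : TransPartition (deleteVertex G u) k
    G-u-transitive = record
      { part = part ∘ punchIn u
      ; nonempty = λ i → let v , ev = nonempty i ; y , e = representative v in y , trans e ev
      ; dominates = dominates′ }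
      where
      dominates′ : ∀ i j → i Fin.< j → ∀ x → part (punchIn u x) ≡ j →
                   ∃ λ y → part (punchIn u y) ≡ i × deleteVertex G u y x ≡ true
      dominates′ i j i<j x ex with dominates i j i<j (punchIn u x) ex
      ... | u₀ , e₁ , e₂ with u₀ ≟ u
      ... | yes refl = ⊥-elim (no-higher _ e₂ (level-< e₁ ex i<j))
      ... | no u₀≢u  = let y , e = survivor u₀≢u
                       in y , trans (cong part e) e₁ , trans (cong (λ z → G z (punchIn u x)) e) e₂

  edge⇒level≢ : ∀ u v → G u v ≡ true → level u ≢ level v
  edge⇒level≢ u v e same = edge-needed u v e dom
    where
    dom : Dominates (deleteEdge G u v)
    dom i j i<j v′ ev′ =
      let u₀ , e₁ , e₂ = dominates i j i<j v′ ev′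
          below = level-< e₁ ev′ i<j
      in u₀ , e₁ , deleteEdge-keeps G e₂ (λ { (refl , refl) → ℕ.<-irrefl same below })
                                         (λ { (refl , refl) → ℕ.<-irrefl (sym same) below })

  lower-neighbour : ∀ v i → i < level v → ∃ λ u → level u ≡ i × G u v ≡ true
  lower-neighbour v i i<lv =
    let u , e₁ , e₂ = dominates (fromℕ< i<k) (part v)
                                (subst (_< level v) (sym (toℕ-fromℕ< i<k)) i<lv) v refl
    in u , trans (cong toℕ e₁) (toℕ-fromℕ< i<k) , e₂
    where
    i<k : i < k
    i<k = ℕ.<-trans i<lv (toℕ<n (part v))

  lower-neighbour-unique : ∀ v u₁ u₂ → level u₁ ≡ level u₂ → level u₁ < level v →
                           G u₁ v ≡ true → G u₂ v ≡ true → u₁ ≡ u₂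
  lower-neighbour-unique v u₁ u₂ same lt g₁ g₂ with u₁ ≟ u₂
  ... | yes u₁≡u₂ = u₁≡u₂
  ... | no u₁≢u₂  = ⊥-elim (edge-needed u₁ v g₁ dom)
    where
    dom : Dominates (deleteEdge G u₁ v)
    dom i j i<j v′ ev′ with dominates i j i<j v′ ev′
    ... | u₀ , e₁ , e₂ with (u₀ ≟ u₁) ×-dec (v′ ≟ v)
    ... | yes (refl , refl) =
          u₂ , toℕ-injective (trans (sym same) (cong toℕ e₁)) ,
          deleteEdge-keeps G g₂ (λ (u₂≡u₁ , _) → u₁≢u₂ (sym u₂≡u₁))
                                (λ { (_ , refl) → ℕ.<-irrefl refl lt })
    ... | no ≢u₁v =
          u₀ , e₁ , deleteEdge-keeps G e₂ ≢u₁v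
                                     (λ { (refl , refl) → ℕ.<-asym lt (level-< e₁ ev′ i<j) })

  higher-neighbour : ∀ u → level u < k′ → ∃ λ v → level u < level v × G u v ≡ true
  higher-neighbour u lt with any? (λ v → (level u ℕ.<? level v) ×-dec (G u v Bool.≟ true))
  ... | yes (v , higher , e) = v , higher , e
  ... | no ∄ = ⊥-elim (∄ (v , higher , subst (λ x → G x v ≡ true) u₀≡u e₂))
    where
    next : Fin k
    next = fromℕ< (s≤s lt)

    level-next : toℕ next ≡ suc (level u)
    level-next = toℕ-fromℕ< (s≤s lt)

    v = proj₁ (nonempty next)
    ev = proj₂ (nonempty next)

    higher : level u < level v
    higher = subst (level u <_) (sym (trans (cong toℕ ev) level-next)) (ℕ.n<1+n _)

    dominator = dominates (part u) next (subst (level u <_) (sym level-next) (ℕ.n<1+n _)) v ev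
    u₀ = proj₁ dominator
    e₂ = proj₂ (proj₂ dominator)

    u₀≡u : u₀ ≡ u
    u₀≡u = alone-in-part u (λ v e l → ∄ (v , l , e)) u₀ (proj₁ (proj₂ dominator))

  level≤k′ : ∀ v → level v ≤ k′
  level≤k′ v = ℕ.≤-pred (toℕ<n (part v))

  top : ∃ λ v → level v ≡ k′
  top = let v , ev = nonempty (fromℕ k′) in v , trans (cong toℕ ev) (toℕ-fromℕ k′)

  top-unique : ∀ u v → level u ≡ k′ → level v ≡ k′ → u ≡ v
  top-unique u v eu ev =
    sym (alone-in-part u (λ w _ l → ℕ.≤⇒≯ (level≤k′ w) (subst (_< level w) eu l))
                       v (toℕ-injective (trans ev (sym eu))))

  layering : Layering k′ G level
  layering = record
    { symmetric = symmetric ; level≤h = level≤k′ ; edge⇒level≢ = edge⇒level≢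
    ; lower-neighbour = lower-neighbour ; lower-neighbour-unique = lower-neighbour-unique
    ; higher-neighbour = higher-neighbour ; top = top ; top-unique = top-unique }

_≅_ : ∀ {m n} → Graph m → Graph n → Set
_≅_ {m} {n} A G = Σ (Fin m ↔ Fin n) λ σ → ∀ x y → A x y ≡ G (Inverse.to σ x) (Inverse.to σ y)

IsAtom : ℕ → ∀ {n} → Graph n → Set
IsAtom t G = ∃₂ λ m (a : Atom t m) → atomGraph a ≅ G

IsAtom⇒InA : ∀ {t n} {G : Graph n} → IsAtom t G → InA t G
IsAtom⇒InA (m , a , σ , a≅G) with ↔⇒≡ σ
... | refl = a , σ , a≅G

-- When f ∘ w = id the matching edge w j — j is itself of the form u — f u, so every old vertex u
-- has exactly one new neighbour, namely f u.
cross-retraction : ∀ {n r} (w : Fin r → Fin n) (f : Fin n → Fin r) → (∀ j → f (w j) ≡ j) →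
                   ∀ u i → cross w f u i ≡ ⌊ f u ≟ i ⌋
cross-retraction w f f∘w u i with w i ≟ u | any? (λ j → w j ≟ u) | f u ≟ i
... | yes refl | _              | yes _    = refl
... | yes refl | _              | no fwi≢i = ⊥-elim (fwi≢i (f∘w i))
... | no _     | yes _          | no _     = refl
... | no wi≢u  | yes (j , refl) | yes refl = ⊥-elim (wi≢u (cong w (f∘w j)))
... | no _     | no _           | yes _    = refl
... | no _     | no _           | no _     = refl

extend-≅ : ∀ {m n r} {A : Graph m} {H : Graph n} ((σ , A≅H) : A ≅ H)
           {w : Fin r → Fin n} {f : Fin n → Fin r} {w′ : Fin r → Fin m} {f′ : Fin m → Fin r} →
           (∀ j → f (w j) ≡ j) → (∀ j → f′ (w′ j) ≡ j) → (∀ u → f′ u ≡ f (Inverse.to σ u)) →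
           ∀ s t → extend A w′ f′ s t ≡ extend H w f (map₁ (Inverse.to σ) s) (map₁ (Inverse.to σ) t)
extend-≅ (σ , A≅H) {w} {f} {w′} {f′} f∘w f′∘w′ f′≗f∘σ = λ where
    (inj₁ u) (inj₁ v) → A≅H u v
    (inj₁ u) (inj₂ i) → cross≅ u i
    (inj₂ i) (inj₁ u) → cross≅ u i
    (inj₂ i) (inj₂ j) → refl
  where
  open Inverse σ using (to)

  cross≅ : ∀ u i → cross w′ f′ u i ≡ cross w f (to u) i
  cross≅ u i = begin
    cross w′ f′ u i      ≡⟨ cross-retraction w′ f′ f′∘w′ u i ⟩
    ⌊ f′ u ≟ i ⌋         ≡⟨ cong (λ x → ⌊ x ≟ i ⌋) (f′≗f∘σ u) ⟩
    ⌊ f (to u) ≟ i ⌋     ≡⟨ cross-retraction w f f∘w (to u) i ⟨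
    cross w f (to u) i   ∎
    where open ≡-Reasoning

module PeelBottom {h n} {G : Graph n} {level : Fin n → ℕ} (L : Layering (suc h) G level) where
  open Layering L
  open Partition (partition n (λ v → level v ℕ.≟ 0)) renaming (#out to n′; #in to r)
  open Inverse enumeration using (to)

  old : Fin n′ → Fin n
  old i = to (inj₁ i)

  new : Fin r → Fin n
  new j = to (inj₂ j)

  old-injective : Injective _≡_ _≡_ old
  old-injective = inj₁-injective ∘ to-injective

  new-injective : Injective _≡_ _≡_ new
  new-injective = inj₂-injective ∘ to-injective

  H : Graph n′
  H i j = G (old i) (old j)

  level′ : Fin n′ → ℕ
  level′ i = pred (level (old i))

  suc-level′ : ∀ i → suc (level′ i) ≡ level (old i)
  suc-level′ i = ℕ.suc-pred _ {{≢-nonZero (out-¬P i)}}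

  level′-≡ : ∀ {i j} → level′ i ≡ level′ j → level (old i) ≡ level (old j)
  level′-≡ {i} {j} eq = trans (sym (suc-level′ i)) (trans (cong suc eq) (suc-level′ j))

  level′-< : ∀ {i j} → level′ i < level′ j → level (old i) < level (old j)
  level′-< {i} {j} lt = subst₂ _<_ (suc-level′ i) (suc-level′ j) (s≤s lt)

  layering′ : Layering h H level′
  layering′ = record
    { symmetric = λ u v → symmetric (old u) (old v)
    ; level≤h = λ v → ℕ.pred-mono-≤ (level≤h (old v))
    ; edge⇒level≢ = λ u v e → edge⇒level≢ (old u) (old v) e ∘ level′-≡
    ; lower-neighbour = lower-neighbour′
    ; lower-neighbour-unique = λ v u₁ u₂ eq lt g₁ g₂ →
        old-injective (lower-neighbour-unique (old v) (old u₁) (old u₂) (level′-≡ eq) (level′-< lt) g₁ g₂)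
    ; higher-neighbour = higher-neighbour′
    ; top = top′
    ; top-unique = λ u v eu ev →
        old-injective (top-unique (old u) (old v) (trans (sym (suc-level′ u)) (cong suc eu))
                                                  (trans (sym (suc-level′ v)) (cong suc ev)))
    }
    where
    lower-neighbour′ : ∀ v i → i < level′ v → ∃ λ u → level′ u ≡ i × H u v ≡ true
    lower-neighbour′ v i lt
      with lower-neighbour (old v) (suc i) (subst (suc i <_) (suc-level′ v) (s≤s lt))
    ... | u , lu , e with out-preimage (ℕ.m<n⇒n≢0 (subst (0 <_) (sym lu) ℕ.0<1+n))
    ... | u′ , refl = u′ , cong pred lu , e

    higher-neighbour′ : ∀ u → level′ u < h → ∃ λ v → level′ u < level′ v × H u v ≡ true
    higher-neighbour′ u lt
      with higher-neighbour (old u) (subst (_< suc h) (suc-level′ u) (s≤s lt))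
    ... | v , higher , e with out-preimage (ℕ.m<n⇒n≢0 higher)
    ... | v′ , refl = v′ , ℕ.pred-mono-< {{≢-nonZero (out-¬P u)}} higher , e

    top′ : ∃ λ v → level′ v ≡ h
    top′ with top
    ... | t , lt with out-preimage {t} (λ l0 → ℕ.0≢1+n (trans (sym l0) lt))
    ... | t′ , refl = t′ , cong pred lt

  up-neighbour : ∀ j → ∃ λ v → level (new j) < level v × G (new j) v ≡ true
  up-neighbour j = higher-neighbour (new j) (subst (_< suc h) (sym (in-P j)) ℕ.0<1+n)

  up : Fin r → Fin n′
  up j = let v , higher , _ = up-neighbour j in proj₁ (out-preimage (ℕ.m<n⇒n≢0 higher))

  G-new-up : ∀ j → G (new j) (old (up j)) ≡ true
  G-new-up j with up-neighbour j
  ... | v , higher , e with out-preimage (ℕ.m<n⇒n≢0 higher)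
  ... | _ , refl = e

  down-neighbour : ∀ i → ∃ λ x → level x ≡ 0 × G x (old i) ≡ true
  down-neighbour i = lower-neighbour (old i) 0 (ℕ.n≢0⇒n>0 (out-¬P i))

  down : Fin n′ → Fin r
  down i = let _ , l0 , _ = down-neighbour i in proj₁ (in-preimage l0)

  G-down-old : ∀ i → G (new (down i)) (old i) ≡ true
  G-down-old i with down-neighbour i
  ... | x , l0 , e with in-preimage l0
  ... | _ , refl = e

  down-unique : ∀ i j → G (new j) (old i) ≡ true → down i ≡ j
  down-unique i j e = new-injective
    (lower-neighbour-unique (old i) _ _ (trans (in-P (down i)) (sym (in-P j)))
                            (subst (_< level (old i)) (sym (in-P (down i))) (ℕ.n≢0⇒n>0 (out-¬P i)))
                            (G-down-old i) e)

  down∘up : ∀ j → down (up j) ≡ j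
  down∘up j = down-unique (up j) j (G-new-up j)

  G-old-new : ∀ i j → G (old i) (new j) ≡ ⌊ down i ≟ j ⌋
  G-old-new i j with down i ≟ j
  ... | yes refl = trans (symmetric _ _) (G-down-old i)
  ... | no di≢j with G (old i) (new j) in e
  ... | false = refl
  ... | true = ⊥-elim (di≢j (down-unique i j (trans (symmetric _ _) e)))

  G-new-new : ∀ i j → G (new i) (new j) ≡ false
  G-new-new i j with G (new i) (new j) in e
  ... | false = refl
  ... | true = ⊥-elim (edge⇒level≢ _ _ e (trans (in-P i) (sym (in-P j))))

  G≡extend : ∀ s t → G (to s) (to t) ≡ extend H up down s t
  G≡extend (inj₁ u) (inj₁ v) = refl
  G≡extend (inj₁ u) (inj₂ j) = trans (G-old-new u j) (sym (cross-retraction up down down∘up u j))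
  G≡extend (inj₂ j) (inj₁ u) = trans (symmetric _ _) (G≡extend (inj₁ u) (inj₂ j))
  G≡extend (inj₂ i) (inj₂ j) = G-new-new i j

  r-positive : 1 ≤ r
  r-positive =
    let t , lt = top
        _ , l0 , _ = lower-neighbour t 0 (subst (0 <_) (sym lt) ℕ.0<1+n)
        j , _ = in-preimage l0
    in >-nonZero⁻¹ r {{nonZeroIndex j}}

  extend-atom : IsAtom (suc h) H → IsAtom (suc (suc h)) G
  extend-atom (m′ , a′ , σ′ , a′≅H) =
    m′ + r , step a′ r r-positive up′ up′-injective down′ ,
    ↔-trans +↔⊎ (↔-trans (⊎-cong σ′ ↔-refl) enumeration) ,
    λ x y → begin
      extend (atomGraph a′) up′ down′ (splitAt m′ x) (splitAt m′ y)
        ≡⟨ extend-≅ (σ′ , a′≅H) down∘up down′∘up′ (λ _ → refl) (splitAt m′ x) (splitAt m′ y) ⟩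
      extend H up down (map₁ σ′.to (splitAt m′ x)) (map₁ σ′.to (splitAt m′ y))
        ≡⟨ G≡extend (map₁ σ′.to (splitAt m′ x)) (map₁ σ′.to (splitAt m′ y)) ⟨
      G (to (map₁ σ′.to (splitAt m′ x))) (to (map₁ σ′.to (splitAt m′ y)))  ∎
    where
    open ≡-Reasoning
    module σ′ = Inverse σ′

    up′ : Fin r → Fin m′
    up′ = σ′.from ∘ up

    down′ : Fin m′ → Fin r
    down′ = down ∘ σ′.to

    down′∘up′ : ∀ j → down′ (up′ j) ≡ j
    down′∘up′ j = trans (cong down (σ′.strictlyInverseˡ (up j))) (down∘up j)

    up′-injective : Injective _≡_ _≡_ up′
    up′-injective = inverseʳ⇒injective {f⁻¹ = down′} up′ (strictlyInverseʳ⇒inverseʳ up′ down′∘up′)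

layering⇒atom : ∀ h {n} {G : Graph n} {level : Fin n → ℕ} → Layering h G level → IsAtom (suc h) G
layering⇒atom zero {G = G} L =
  1 , base ,
  mk↔ₛ′ (λ _ → t) (λ _ → zero) (λ v → top-unique t v lt (ℕ.n≤0⇒n≡0 (level≤h v))) (λ { zero → refl }) ,
  λ { zero zero → no-loop }
  where
  open Layering L
  t = proj₁ top
  lt = proj₂ top

  no-loop : false ≡ G t t
  no-loop with G t t in e
  ... | false = refl
  ... | true  = ⊥-elim (edge⇒level≢ t t e refl)
layering⇒atom (suc h) L = PeelBottom.extend-atom L (layering⇒atom h (PeelBottom.layering′ L))

critical⇒atom : ∀ k′ {n} (G : Graph n) → IsSimple G → Critical (suc k′) G → IsAtom (suc k′) G
critical⇒atom k′ {zero}  G _ ((partition , _) , _) =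
  ⊥-elim (¬Fin0 (proj₁ (TransPartition.nonempty partition zero)))
critical⇒atom k′ {suc m} G (symmetric , _) critical =
  layering⇒atom k′ (CriticalLayering.layering G symmetric critical)

theorem5 : (k : ℕ) → 1 ≤ k → (n : ℕ) (G : Graph n) → IsSimple G →
           (Critical k G ⇔ InA' k G)
theorem5 (suc k′) _ n G simple = mk⇔
  (λ critical → IsAtom⇒InA {G = G} (critical⇒atom k′ G simple critical) , λ where
     (_ , inj₁ ¬critical) → ¬critical critical
     (_ , inj₂ ¬trIs)     → ¬trIs (proj₁ critical))
  (λ (inA , ∉B) → critical-stable (suc k′) G (λ ¬critical → ∉B (inA , inj₁ ¬critical)))
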